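{- Let $G=(V,E,w)$ be a weighted undirected graph, let $k\ge 1$ and $r\ge 2$ be integers, and let $V=V_0\supseteq V_1\supseteq\cdots\supseteq V_k\supseteq V_{k+1}=\emptyset$. Let $H=E_0\cup\cdots\cup E_k$ be the edge set defined below, and let $h_0=1$ and $h_i=(r+1)h_{i-1}+r$ for $i\in[1,k]$. Then for any real $\mu$, for all $i\in[0,k]$ and all $u,v\in V$ with $\dist_G(u,v)\le r^i\mu$, at least one of the following holds: (i) $\dist^{(h_i)}_{G\cup H}(u,v)\le \dist_G(u,v) + ((r+4)^i - r^i)\mu$; (ii) there exists $u_{i+1}\in V_{i+1}$ with $\dist^{(h_i)}_{G\cup H}(u,u_{i+1})\le (r+4)^i\mu$.
   Context: $\dist_G(u,v)$ is the shortest-path distance in $G$ (nonnegative edge lengths), and $\dist^{(\beta)}_{G\cup H}(u,v)$ is the length of a shortest $u$--$v$ path using at most $\beta$ edges in the graph $G\cup H$ obtained by adding the weighted edges of $H$ to $G$. For $v\in V$ and $i\in[1,k]$, $p_i(v)$ is any vertex of $V_i$ with $\dist_G(v,p_i(v))=\dist_G(v,V_i)$; by convention $p_{k+1}(v)$ does not exist and $\dist_G(v,p_{k+1}(v))=\infty$. For $v\in V_i\setminus V_{i+1}$, define $\mathcal{B}(v)=\{u\in V_i : \dist_G(v,u)<\dist_G(v,p_{i+1}(v))\}$. For $i\in[0,k]$, $E_i=\bigcup_{v\in V_i\setminus V_{i+1}}\{(v,u) : u\in\mathcal{B}(v)\cup\{p_{i+1}(v)\}\}$ (with $p_{i+1}(v)$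 included only if it exists), and every edge $(x,y)\in H$ has length $\dist_G(x,y)$. -}

module Defs where

open import Level using (Level; _⊔_) renaming (suc to lsuc)
open import Data.Nat as ℕ using (ℕ; zero; suc; _^_)
open import Data.Fin using (Fin)
open import Data.List using (List)
open import Data.List.Membership.Propositional using (_∈_)
open import Data.Maybe using (Maybe; just; nothing; maybe)
open import Data.Product using (Σ; Σ-syntax; _×_; _,_)
open import Data.Sum using (_⊎_)
open import Data.Unit using (⊤)
open import Data.Empty using (⊥)
open import Relation.Nullary using (¬_)
open import Relation.Binary.PropositionalEquality using (_≡_; _≢_)
open import Relation.Binary using (Rel; IsTotalOrder)
open import Algebra.Structures using (IsCommutativeRing)

-- An ordered commutative ring (ℝ is an instance).  Edge weights and μ live here.
record OrderedCommRing (a b : Level) : Set (lsuc (a ⊔ b)) where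
  infixl 7 _*_
  infixl 6 _+_
  infix 4 _≤_
  field
    Carrier : Set a
    _+_ _*_ : Carrier → Carrier → Carrier
    -_ : Carrier → Carrier
    0# 1# : Carrier
    isCommutativeRing : IsCommutativeRing _≡_ _+_ _*_ -_ 0# 1#
    _≤_ : Rel Carrier b
    isTotalOrder : IsTotalOrder _≡_ _≤_
    +-mono-≤ : ∀ {x y} z → x ≤ y → x + z ≤ y + z
    *-nonneg : ∀ {x y} → 0# ≤ x → 0# ≤ y → 0# ≤ x * y

hop : ℕ → ℕ → ℕ
hop r zero = 1
hop r (suc i) = (r ℕ.+ 1) ℕ.* hop r i ℕ.+ r

module WithRing {a b : Level} (O : OrderedCommRing a b) where
  open OrderedCommRing O

  _-_ : Carrier → Carrier → Carrier
  x - y = x + (- y)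

  _<_ : Carrier → Carrier → Set (a ⊔ b)
  x < y = (x ≤ y) × (x ≢ y)

  ι : ℕ → Carrier
  ι zero = 0#
  ι (suc m) = 1# + ι m

  data Ext : Set a where
    fin : Carrier → Ext
    ∞ : Ext

  _+ᵉ_ : Ext → Ext → Ext
  fin x +ᵉ fin y = fin (x + y)
  fin x +ᵉ ∞ = ∞
  ∞ +ᵉ _ = ∞

  _≤ᵉ_ : Ext → Ext → Set (a ⊔ b)
  fin x ≤ᵉ fin y = Level.Lift (a ⊔ b) (x ≤ y)
  _ ≤ᵉ ∞ = Level.Lift (a ⊔ b) ⊤
  ∞ ≤ᵉ fin _ = Level.Lift (a ⊔ b) ⊥

  _<ᵉ_ : Ext → Ext → Set (a ⊔ b)
  fin x <ᵉ fin y = x < y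
  fin x <ᵉ ∞ = Level.Lift (a ⊔ b) ⊤
  ∞ <ᵉ _ = Level.Lift (a ⊔ b) ⊥

  module Graph (n : ℕ) where
    -- an edge relation: R x y w means an edge x→y of length w
    EdgeRel : (ℓ : Level) → Set (a ⊔ lsuc ℓ)
    EdgeRel ℓ = Fin n → Fin n → Ext → Set ℓ

    data Walk {ℓ} (R : EdgeRel ℓ) : Fin n → Fin n → Set (a ⊔ ℓ) where
      []   : ∀ {u} → Walk R u u
      step : ∀ {x y v} (w : Ext) → R x y w → Walk R y v → Walk R x v

    len : ∀ {ℓ} {R : EdgeRel ℓ} {u v} → Walk R u v → Ext
    len [] = fin 0#
    len (step w _ W) = w +ᵉ len W

    hops : ∀ {ℓ} {R : EdgeRel ℓ} {u v} → Walk R u v → ℕ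
    hops [] = 0
    hops (step _ _ W) = suc (hops W)

    -- undirected weighted graph G given by a list of edges (x , y , w)
    EdgeList : Set a
    EdgeList = List (Fin n × Fin n × Carrier)

    GRel : EdgeList → EdgeRel a
    GRel E x y w = Σ[ c ∈ Carrier ] (w ≡ fin c × ((x , y , c) ∈ E ⊎ (y , x , c) ∈ E))

    IsDist : EdgeList → Fin n → Fin n → Ext → Set (a ⊔ b)
    IsDist E u v δ =
      (∀ (W : Walk (GRel E) u v) → δ ≤ᵉ len W)
      × (δ ≡ ∞ ⊎ Σ[ W ∈ Walk (GRel E) u v ] δ ≡ len W)

    -- the hierarchy V = V_0 ⊇ V_1 ⊇ … ⊇ V_k ⊇ V_{k+1} = ∅ is encoded by a level
    -- function lev with lev v ≤ k; v ∈ V_i  iff  i ≤ lev v.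
    -- pv = p_i(v) (nothing iff V_i = ∅), d the distance function of G.
    IsNearest : (d : Fin n → Fin n → Ext) (lev : Fin n → ℕ)
                (i : ℕ) (v : Fin n) → Maybe (Fin n) → Set (a ⊔ b)
    IsNearest d lev i v pv =
      (pv ≡ nothing × (∀ x → ¬ (i ℕ.≤ lev x)))
      ⊎ Σ[ x ∈ Fin n ] (pv ≡ just x × i ℕ.≤ lev x
                         × (∀ y → i ℕ.≤ lev y → d v x ≤ᵉ d v y))

    module Hopset (d : Fin n → Fin n → Ext) (lev : Fin n → ℕ)
                  (p : ℕ → Fin n → Maybe (Fin n)) where
      dp : ℕ → Fin n → Ext
      dp i v = maybe (d v) ∞ (p i v)

      -- (v , u) ∈ E_i with i = lev v, i.e. v ∈ V_i ∖ V_{i+1}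
      InE : Fin n → Fin n → Set (a ⊔ b)
      InE v u = (lev v ℕ.≤ lev u × d v u <ᵉ dp (suc (lev v)) v)
                ⊎ Level.Lift (a ⊔ b) (p (suc (lev v)) v ≡ just u)

      InH : Fin n → Fin n → Set (a ⊔ b)
      InH x y = InE x y ⊎ InE y x

      GHRel : EdgeList → Fin n → Fin n → Ext → Set (a ⊔ b)
      GHRel E x y w = GRel E x y w ⊎ (InH x y × w ≡ d x y)

-- Induction on i with R = r^i μ, S = ((r+4)^i − r^i) μ and T = (r+4)^i μ, so that R + S = T.
-- A shortest u–v path of length at most r R is cut into at most r segments of length at
-- most R, joined by single edges.  The induction hypothesis, applied to a segment in both
-- directions, either gives a short walk across it or escapes from both of its ends into
-- V_{i+1}.  If no segment is blocked, the short walks and the joining edges form the walk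
-- of (i).  Otherwise let u′ escape from the start of the first blocked segment and w from
-- the end of the last one.  If u′ ∈ V_{i+2} we escape; otherwise either w lies in the ball
-- B(u′) and the edge (u′, w) ∈ E_{i+1} bridges everything in between, or p_{i+2}(u′) is no
-- farther than w and one edge of E_{i+1} escapes to it.  Each segment costs at most h_i + 1
-- hops and error S, and the escapes add at most 4T, which gives h_{i+1} = (r+1) h_i + r and
-- the error r S + 4T = ((r+4)^{i+1} − r^{i+1}) μ.
module Submission where

open import Defs
open import Level using (Level; _⊔_; lift; lower)
import Data.Nat as ℕ
import Data.Nat.Properties as ℕₚ
import Data.Nat.Solver
open import Data.Nat using (ℕ; zero; suc; _^_; z≤n; s≤s)
open import Data.Bool using (Bool; true; false)
open import Data.Fin using (Fin)
open import Data.List.Membership.Propositional using (_∈_)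
open import Data.Maybe using (Maybe; maybe)
open import Data.Product using (Σ-syntax; _×_; _,_; proj₁; proj₂)
open import Data.Sum using (_⊎_; inj₁; inj₂)
open import Data.Unit using (tt)
open import Data.Empty using (⊥)
open import Relation.Nullary using (¬_; Dec; yes; no)
open import Relation.Binary using (IsTotalOrder)
open import Relation.Binary.Bundles using (Poset)
open import Relation.Binary.PropositionalEquality
  using (_≡_; refl; sym; trans; cong; cong₂; subst; subst₂; module ≡-Reasoning)
open import Algebra.Bundles using (CommutativeRing)
open import Algebra.Structures using (IsCommutativeRing)
import Algebra.Properties.Ring as RingProperties
import Algebra.Solver.Ring.NaturalCoefficients.Default as SemiringSolver
import Relation.Binary.Reasoning.PartialOrder as PosetReasoning

-- slack r i = (r+4)^i − r^i, defined without truncated subtraction.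
slack : ℕ → ℕ → ℕ
slack r zero = 0
slack r (suc i) = r ℕ.* slack r i ℕ.+ 4 ℕ.* (r ℕ.+ 4) ^ i

^+slack≡[+4]^ : ∀ r i → r ^ i ℕ.+ slack r i ≡ (r ℕ.+ 4) ^ i
^+slack≡[+4]^ r zero = refl
^+slack≡[+4]^ r (suc i) = begin
  r ℕ.* r ^ i ℕ.+ (r ℕ.* slack r i ℕ.+ 4 ℕ.* (r ℕ.+ 4) ^ i)
    ≡⟨ solve 4 (λ r x s a → r :* x :+ (r :* s :+ con 4 :* a) := r :* (x :+ s) :+ con 4 :* a)
             refl r (r ^ i) (slack r i) ((r ℕ.+ 4) ^ i) ⟩
  r ℕ.* (r ^ i ℕ.+ slack r i) ℕ.+ 4 ℕ.* (r ℕ.+ 4) ^ i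
    ≡⟨ cong (λ t → r ℕ.* t ℕ.+ 4 ℕ.* (r ℕ.+ 4) ^ i) (^+slack≡[+4]^ r i) ⟩
  r ℕ.* (r ℕ.+ 4) ^ i ℕ.+ 4 ℕ.* (r ℕ.+ 4) ^ i
    ≡⟨ ℕₚ.*-distribʳ-+ ((r ℕ.+ 4) ^ i) r 4 ⟨
  (r ℕ.+ 4) ℕ.* (r ℕ.+ 4) ^ i ∎
  where open ≡-Reasoning
        open Data.Nat.Solver.+-*-Solver using (solve; _:=_; _:+_; _:*_; con)

hop-suc : ∀ r i → r ℕ.* suc (hop r i) ℕ.+ hop r i ≡ hop r (suc i)
hop-suc r i = solve 2 (λ r h → r :* (con 1 :+ h) :+ h := (r :+ con 1) :* h :+ r) refl r (hop r i)
  where open Data.Nat.Solver.+-*-Solver using (solve; _:=_; _:+_; _:*_; con)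

prepend-budget : ∀ {p q} m h → p ℕ.≤ h → q ℕ.≤ m ℕ.* suc h ℕ.+ h →
                 p ℕ.+ suc q ℕ.≤ suc m ℕ.* suc h ℕ.+ h
prepend-budget {p} {q} m h p≤h q≤ = begin
  p ℕ.+ suc q                       ≡⟨ ℕₚ.+-suc p q ⟩
  suc (p ℕ.+ q)                     ≤⟨ s≤s (ℕₚ.+-mono-≤ p≤h q≤) ⟩
  suc h ℕ.+ (m ℕ.* suc h ℕ.+ h)     ≡⟨ ℕₚ.+-assoc (suc h) (m ℕ.* suc h) h ⟨
  suc m ℕ.* suc h ℕ.+ h             ∎
  where open ℕₚ.≤-Reasoning

module OrderedRingProperties {a b : Level} (O : OrderedCommRing a b) where
  open OrderedCommRing O
  open WithRing O

  open IsCommutativeRing isCommutativeRing public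
    using (+-assoc; +-comm; +-identityˡ; +-identityʳ; -‿inverseˡ; -‿inverseʳ;
           *-assoc; distribˡ; distribʳ; zeroˡ; zeroʳ)
  open IsTotalOrder isTotalOrder public
    using (total; antisym) renaming (refl to ≤-refl; trans to ≤-trans; reflexive to ≤-reflexive)

  commutativeRing : CommutativeRing a a
  commutativeRing = record { isCommutativeRing = isCommutativeRing }

  poset : Poset a a b
  poset = record { isPartialOrder = IsTotalOrder.isPartialOrder isTotalOrder }

  module ≤-Reasoning = PosetReasoning poset

  open SemiringSolver (CommutativeRing.commutativeSemiring commutativeRing) public
    using (solve; _:=_; _:+_; _:*_; con; Polynomial)

  -- Denotes ι m definitionally, which the solver's own  con m  does not.
  :ι : ∀ {k} → ℕ → Polynomial k
  :ι zero = con 0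
  :ι (suc m) = con 1 :+ :ι m

  private
    tag : ∀ {ℓ} {A B : Set ℓ} → A ⊎ B → Bool
    tag (inj₁ _) = true
    tag (inj₂ _) = false

  -- On the diagonal  total x y  and  total y x  are the same term, so their
  -- tags agree; two different tags therefore certify  x ≢ y.
  _≟_ : (x y : Carrier) → Dec (x ≡ y)
  x ≟ y with total x y in xy | total y x in yx
  ... | inj₁ x≤y | inj₁ y≤x = yes (antisym x≤y y≤x)
  ... | inj₂ y≤x | inj₂ x≤y = yes (antisym x≤y y≤x)
  ... | inj₁ _   | inj₂ _   = no λ { refl → true≢false (trans (cong tag (sym xy)) (cong tag yx)) }
    where true≢false : true ≡ false → ⊥
          true≢false ()
  ... | inj₂ _   | inj₁ _   = no λ { refl → false≢true (trans (cong tag (sym xy)) (cong tag yx)) }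
    where false≢true : false ≡ true → ⊥
          false≢true ()

  +-monoʳ-≤ : ∀ z {x y} → x ≤ y → z + x ≤ z + y
  +-monoʳ-≤ z {x} {y} x≤y = subst₂ _≤_ (+-comm x z) (+-comm y z) (+-mono-≤ z x≤y)

  +-mono₂-≤ : ∀ {x y u v} → x ≤ y → u ≤ v → x + u ≤ y + v
  +-mono₂-≤ {y = y} {u} x≤y u≤v = ≤-trans (+-mono-≤ u x≤y) (+-monoʳ-≤ y u≤v)

  x≤x+y : ∀ x {y} → 0# ≤ y → x ≤ x + y
  x≤x+y x {y} 0≤y = subst (_≤ x + y) (+-identityʳ x) (+-monoʳ-≤ x 0≤y)

  +-nonneg : ∀ {x y} → 0# ≤ x → 0# ≤ y → 0# ≤ x + y
  +-nonneg {y = y} 0≤x 0≤y = ≤-trans 0≤x (x≤x+y _ 0≤y)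

  x+y-x≡y : ∀ x y → (x + y) - x ≡ y
  x+y-x≡y x y = trans (solve 3 (λ x y x⁻ → x :+ y :+ x⁻ := y :+ (x :+ x⁻)) refl x y (- x))
                      (trans (cong (y +_) (-‿inverseʳ x)) (+-identityʳ y))

  +-cancelˡ-≤ : ∀ x {y z} → x + y ≤ x + z → y ≤ z
  +-cancelˡ-≤ x {y} {z} le = subst₂ _≤_ (x+y-x≡y x y) (x+y-x≡y x z) (+-mono-≤ (- x) le)

  *-monoˡ-≤ : ∀ {c x y} → 0# ≤ c → x ≤ y → c * x ≤ c * y
  *-monoˡ-≤ {c} {x} {y} 0≤c x≤y = subst₂ _≤_ (+-identityˡ (c * x)) split (+-mono-≤ (c * x) 0≤c[y-x])
    where
    0≤c[y-x] : 0# ≤ c * (y - x)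
    0≤c[y-x] = *-nonneg 0≤c (subst (_≤ y - x) (-‿inverseʳ x) (+-mono-≤ (- x) x≤y))
    split : c * (y - x) + c * x ≡ c * y
    split = trans (solve 4 (λ c y x⁻ x → c :* (y :+ x⁻) :+ c :* x := c :* y :+ c :* (x⁻ :+ x)) refl c y (- x) x)
                  (trans (cong (λ t → c * y + c * t) (-‿inverseˡ x))
                         (trans (cong (c * y +_) (zeroʳ c)) (+-identityʳ (c * y))))

  0≤1 : 0# ≤ 1#
  0≤1 with total 0# 1#
  ... | inj₁ 0≤1 = 0≤1
  ... | inj₂ 1≤0 = subst (0# ≤_) -1*-1≡1 (*-nonneg 0≤-1 0≤-1)
    where
    open RingProperties (CommutativeRing.ring commutativeRing) using (-1*x≈-x; -‿involutive)
    0≤-1 : 0# ≤ - 1#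
    0≤-1 = subst₂ _≤_ (-‿inverseʳ 1#) (+-identityˡ (- 1#)) (+-mono-≤ (- 1#) 1≤0)
    -1*-1≡1 : - 1# * - 1# ≡ 1#
    -1*-1≡1 = trans (-1*x≈-x (- 1#)) (-‿involutive 1#)

  ι-nonneg : ∀ m → 0# ≤ ι m
  ι-nonneg zero = ≤-refl
  ι-nonneg (suc m) = +-nonneg 0≤1 (ι-nonneg m)

  ι-+ : ∀ m k → ι (m ℕ.+ k) ≡ ι m + ι k
  ι-+ zero k = sym (+-identityˡ (ι k))
  ι-+ (suc m) k = trans (cong (1# +_) (ι-+ m k)) (sym (+-assoc 1# (ι m) (ι k)))

  ι-* : ∀ m k → ι (m ℕ.* k) ≡ ι m * ι k
  ι-* zero k = sym (zeroˡ (ι k))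
  ι-* (suc m) k = trans (ι-+ k (m ℕ.* k)) (trans (cong (ι k +_) (ι-* m k))
    (solve 2 (λ m k → k :+ m :* k := (con 1 :+ m) :* k) refl (ι m) (ι k)))

  ι*-+ : ∀ m k x → ι (m ℕ.+ k) * x ≡ ι m * x + ι k * x
  ι*-+ m k x = trans (cong (_* x) (ι-+ m k)) (distribʳ x (ι m) (ι k))

  ι*-* : ∀ m k x → ι (m ℕ.* k) * x ≡ ι m * (ι k * x)
  ι*-* m k x = trans (cong (_* x) (ι-* m k)) (*-assoc (ι m) (ι k) x)

  ι*-suc : ∀ m x → ι (suc m) * x ≡ x + ι m * x
  ι*-suc m x = solve 2 (λ m x → (con 1 :+ m) :* x := x :+ m :* x) refl (ι m) x

  ι*-nonneg : ∀ m {x} → 0# ≤ x → 0# ≤ ι m * x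
  ι*-nonneg m 0≤x = *-nonneg (ι-nonneg m) 0≤x

  ι*-≤-ι*-suc : ∀ m {x} → 0# ≤ x → ι m * x ≤ ι (suc m) * x
  ι*-≤-ι*-suc m {x} 0≤x = subst₂ _≤_ (+-identityˡ (ι m * x)) (sym (ι*-suc m x)) (+-mono-≤ (ι m * x) 0≤x)

  nonneg-of-multiple : ∀ {m x} → 1 ℕ.≤ m → 0# ≤ ι m * x → 0# ≤ x
  nonneg-of-multiple {suc m} {x} _ 0≤mx with total 0# x
  ... | inj₁ 0≤x = 0≤x
  ... | inj₂ x≤0 = ≤-trans 0≤mx (begin
    ι (suc m) * x  ≡⟨ ι*-suc m x ⟩
    x + ι m * x    ≤⟨ +-monoʳ-≤ x (subst (ι m * x ≤_) (zeroʳ (ι m)) (*-monoˡ-≤ (ι-nonneg m) x≤0)) ⟩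
    x + 0#         ≡⟨ +-identityʳ x ⟩
    x              ∎)
    where open ≤-Reasoning

module ExtendedProperties {a b : Level} (O : OrderedCommRing a b) where
  open OrderedCommRing O
  open WithRing O
  open OrderedRingProperties O

  ≤ᵉ-refl : ∀ {x} → x ≤ᵉ x
  ≤ᵉ-refl {fin x} = lift ≤-refl
  ≤ᵉ-refl {∞} = lift tt

  ≤ᵉ-reflexive : ∀ {x y} → x ≡ y → x ≤ᵉ y
  ≤ᵉ-reflexive refl = ≤ᵉ-refl

  x≤ᵉ∞ : ∀ x → x ≤ᵉ ∞
  x≤ᵉ∞ (fin x) = lift tt
  x≤ᵉ∞ ∞ = lift tt

  ≤ᵉ-trans : ∀ {x y z} → x ≤ᵉ y → y ≤ᵉ z → x ≤ᵉ z
  ≤ᵉ-trans {fin x} {fin y} {fin z} (lift x≤y) (lift y≤z) = lift (≤-trans x≤y y≤z)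
  ≤ᵉ-trans {fin x} {∞}     {fin z} _ (lift ())
  ≤ᵉ-trans {∞}     {fin y}         (lift ()) _
  ≤ᵉ-trans {∞}     {∞}     {fin z} _ (lift ())
  ≤ᵉ-trans {z = ∞} _ _ = x≤ᵉ∞ _

  ≤ᵉ-antisym : ∀ {x y} → x ≤ᵉ y → y ≤ᵉ x → x ≡ y
  ≤ᵉ-antisym {fin x} {fin y} (lift x≤y) (lift y≤x) = cong fin (antisym x≤y y≤x)
  ≤ᵉ-antisym {fin x} {∞} _ (lift ())
  ≤ᵉ-antisym {∞} {fin y} (lift ()) _
  ≤ᵉ-antisym {∞} {∞} _ _ = refl

  +ᵉ-mono-≤ᵉ : ∀ {x x′ y y′} → x ≤ᵉ x′ → y ≤ᵉ y′ → (x +ᵉ y) ≤ᵉ (x′ +ᵉ y′)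
  +ᵉ-mono-≤ᵉ {fin x} {fin x′} {fin y} {fin y′} (lift x≤x′) (lift y≤y′) =
    lift (+-mono₂-≤ x≤x′ y≤y′)
  +ᵉ-mono-≤ᵉ {fin x} {fin x′} {∞} {fin y′} _ (lift ())
  +ᵉ-mono-≤ᵉ {∞} {fin x′} (lift ()) _
  +ᵉ-mono-≤ᵉ {x′ = fin x′} {y′ = ∞} _ _ = x≤ᵉ∞ _
  +ᵉ-mono-≤ᵉ {x′ = ∞} _ _ = x≤ᵉ∞ _

  +ᵉ-identityˡ : ∀ x → (fin 0# +ᵉ x) ≡ x
  +ᵉ-identityˡ (fin x) = cong fin (+-identityˡ x)
  +ᵉ-identityˡ ∞ = refl

  +ᵉ-identityʳ : ∀ x → (x +ᵉ fin 0#) ≡ x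
  +ᵉ-identityʳ (fin x) = cong fin (+-identityʳ x)
  +ᵉ-identityʳ ∞ = refl

  +ᵉ-assoc : ∀ x y z → ((x +ᵉ y) +ᵉ z) ≡ (x +ᵉ (y +ᵉ z))
  +ᵉ-assoc (fin x) (fin y) (fin z) = cong fin (+-assoc x y z)
  +ᵉ-assoc (fin x) (fin y) ∞ = refl
  +ᵉ-assoc (fin x) ∞ z = refl
  +ᵉ-assoc ∞ y z = refl

  +ᵉ-comm : ∀ x y → (x +ᵉ y) ≡ (y +ᵉ x)
  +ᵉ-comm (fin x) (fin y) = cong fin (+-comm x y)
  +ᵉ-comm (fin x) ∞ = refl
  +ᵉ-comm ∞ (fin y) = refl
  +ᵉ-comm ∞ ∞ = refl

  ≤ᵉ-fin⇒fin : ∀ {x c} → x ≤ᵉ fin c → Σ[ y ∈ Carrier ] x ≡ fin y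
  ≤ᵉ-fin⇒fin {fin y} _ = y , refl
  ≤ᵉ-fin⇒fin {∞} (lift ())

  ≤ᵉ-weaken : ∀ {x c c′} → x ≤ᵉ fin c → c ≤ c′ → x ≤ᵉ fin c′
  ≤ᵉ-weaken x≤c c≤c′ = ≤ᵉ-trans x≤c (lift c≤c′)

  ≤ᵉ-rewrite : ∀ {x c c′} → x ≤ᵉ fin c → c ≡ c′ → x ≤ᵉ fin c′
  ≤ᵉ-rewrite x≤c refl = x≤c

  <ᵉ⊎≥ᵉ : ∀ x y → fin x <ᵉ y ⊎ y ≤ᵉ fin x
  <ᵉ⊎≥ᵉ x ∞ = inj₁ (lift tt)
  <ᵉ⊎≥ᵉ x (fin y) with total y x
  ... | inj₁ y≤x = inj₂ (lift y≤x)
  ... | inj₂ x≤y with x ≟ y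
  ...   | yes refl = inj₂ (lift ≤-refl)
  ...   | no x≢y = inj₁ (x≤y , x≢y)

module WalkProperties {a b : Level} (O : OrderedCommRing a b) (n : ℕ) where
  open OrderedCommRing O
  open WithRing O
  open Graph n
  open ExtendedProperties O

  infixr 5 _++ʷ_
  _++ʷ_ : ∀ {ℓ} {R : EdgeRel ℓ} {x y z} → Walk R x y → Walk R y z → Walk R x z
  [] ++ʷ W = W
  step w e V ++ʷ W = step w e (V ++ʷ W)

  len-++ : ∀ {ℓ} {R : EdgeRel ℓ} {x y z} (V : Walk R x y) (W : Walk R y z) →
           len (V ++ʷ W) ≡ (len V +ᵉ len W)
  len-++ [] W = sym (+ᵉ-identityˡ (len W))
  len-++ (step w e V) W = trans (cong (w +ᵉ_) (len-++ V W)) (sym (+ᵉ-assoc w (len V) (len W)))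

  hops-++ : ∀ {ℓ} {R : EdgeRel ℓ} {x y z} (V : Walk R x y) (W : Walk R y z) →
            hops (V ++ʷ W) ≡ hops V ℕ.+ hops W
  hops-++ [] W = refl
  hops-++ (step w e V) W = cong suc (hops-++ V W)

  Symmetric : ∀ {ℓ} → EdgeRel ℓ → Set (a ⊔ ℓ)
  Symmetric R = ∀ {x y w} → R x y w → R y x w

  module _ {ℓ} {R : EdgeRel ℓ} (R-sym : Symmetric R) where

    reverse : ∀ {x y} → Walk R x y → Walk R y x
    reverse [] = []
    reverse (step w e W) = reverse W ++ʷ step w (R-sym e) []

    len-reverse : ∀ {x y} (W : Walk R x y) → len (reverse W) ≡ len W
    len-reverse [] = refl
    len-reverse (step w e W) = begin
      len (reverse W ++ʷ step w (R-sym e) [])  ≡⟨ len-++ (reverse W) _ ⟩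
      len (reverse W) +ᵉ (w +ᵉ fin 0#)         ≡⟨ cong₂ _+ᵉ_ (len-reverse W) (+ᵉ-identityʳ w) ⟩
      len W +ᵉ w                               ≡⟨ +ᵉ-comm (len W) w ⟩
      w +ᵉ len W                               ∎
      where open ≡-Reasoning

    hops-reverse : ∀ {x y} (W : Walk R x y) → hops (reverse W) ≡ hops W
    hops-reverse [] = refl
    hops-reverse (step w e W) = trans (hops-++ (reverse W) _)
      (trans (ℕₚ.+-comm (hops (reverse W)) 1) (cong suc (hops-reverse W)))

module Distances {a b : Level} (O : OrderedCommRing a b) (n : ℕ) where
  open OrderedCommRing O
  open WithRing O
  open Graph n
  open OrderedRingProperties O
  open ExtendedProperties O
  open WalkProperties O n

  GRel-sym : ∀ {E} → Symmetric (GRel E)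
  GRel-sym (c , w≡c , inj₁ xy∈E) = c , w≡c , inj₂ xy∈E
  GRel-sym (c , w≡c , inj₂ yx∈E) = c , w≡c , inj₁ yx∈E

  module Shortest (E : EdgeList) (E-nonneg : ∀ x y c → (x , y , c) ∈ E → 0# ≤ c)
                  (d : Fin n → Fin n → Ext) (d-isDist : ∀ u v → IsDist E u v (d u v)) where

    G : EdgeRel a
    G = GRel E

    lenᴳ : ∀ {x y} → Walk G x y → Carrier
    lenᴳ [] = 0#
    lenᴳ (step _ (c , _) W) = c + lenᴳ W

    len≡lenᴳ : ∀ {x y} (W : Walk G x y) → len W ≡ fin (lenᴳ W)
    len≡lenᴳ [] = refl
    len≡lenᴳ (step _ (c , refl , _) W) = cong (fin c +ᵉ_) (len≡lenᴳ W)

    edge-nonneg : ∀ {x y w} (e : G x y w) → 0# ≤ proj₁ e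
    edge-nonneg (c , _ , inj₁ xy∈E) = E-nonneg _ _ c xy∈E
    edge-nonneg (c , _ , inj₂ yx∈E) = E-nonneg _ _ c yx∈E

    lenᴳ-nonneg : ∀ {x y} (W : Walk G x y) → 0# ≤ lenᴳ W
    lenᴳ-nonneg [] = ≤-refl
    lenᴳ-nonneg (step _ e W) = +-nonneg (edge-nonneg e) (lenᴳ-nonneg W)

    d≤len : ∀ {x y} (W : Walk G x y) → d x y ≤ᵉ len W
    d≤len W = proj₁ (d-isDist _ _) W

    d≤lenᴳ : ∀ {x y} (W : Walk G x y) → d x y ≤ᵉ fin (lenᴳ W)
    d≤lenᴳ W = subst (d _ _ ≤ᵉ_) (len≡lenᴳ W) (d≤len W)

    d≤edge : ∀ {x y w} → G x y w → d x y ≤ᵉ w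
    d≤edge {w = w} e = subst (d _ _ ≤ᵉ_) (+ᵉ-identityʳ w) (d≤len (step w e []))

    shortest-walk : ∀ {x y c} → d x y ≡ fin c → Σ[ W ∈ Walk G x y ] lenᴳ W ≡ c
    shortest-walk {x} {y} d≡c with proj₂ (d-isDist x y)
    ... | inj₁ d≡∞ with trans (sym d≡c) d≡∞
    ...   | ()
    shortest-walk {x} {y} d≡c | inj₂ (W , d≡W) with trans (sym d≡c) (trans d≡W (len≡lenᴳ W))
    ...   | refl = W , refl

    d≤fin⇒nonneg : ∀ {x y c} → d x y ≤ᵉ fin c → 0# ≤ c
    d≤fin⇒nonneg {x} {y} d≤c with ≤ᵉ-fin⇒fin d≤c
    ... | δ , d≡δ with shortest-walk d≡δ
    ...   | W , refl = ≤-trans (lenᴳ-nonneg W) (lower (subst (_≤ᵉ _) d≡δ d≤c))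

    d-sym : ∀ x y → d x y ≡ d y x
    d-sym x y = ≤ᵉ-antisym (reversed y x) (reversed x y)
      where
      reversed : ∀ x y → d y x ≤ᵉ d x y
      reversed x y with proj₂ (d-isDist x y)
      ... | inj₁ d≡∞ = subst (d y x ≤ᵉ_) (sym d≡∞) (x≤ᵉ∞ _)
      ... | inj₂ (W , d≡W) = subst (d y x ≤ᵉ_) (trans (len-reverse GRel-sym W) (sym d≡W))
                                   (d≤len (reverse GRel-sym W))

    triangle : ∀ x y z → d x z ≤ᵉ (d x y +ᵉ d y z)
    triangle x y z with proj₂ (d-isDist x y) | proj₂ (d-isDist y z)
    ... | inj₁ d≡∞ | _ = subst (λ t → d x z ≤ᵉ (t +ᵉ d y z)) (sym d≡∞) (x≤ᵉ∞ _)
    ... | inj₂ _ | inj₁ d≡∞ = subst (λ t → d x z ≤ᵉ (d x y +ᵉ t)) (sym d≡∞)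
                                 (subst (d x z ≤ᵉ_) (+ᵉ-comm ∞ (d x y)) (x≤ᵉ∞ _))
    ... | inj₂ (V , d≡V) | inj₂ (W , d≡W) =
      subst (d x z ≤ᵉ_) (trans (len-++ V W) (sym (cong₂ _+ᵉ_ d≡V d≡W))) (d≤len (V ++ʷ W))

    triangle-≤ : ∀ {x y z α β} → d x y ≤ᵉ fin α → d y z ≤ᵉ fin β → d x z ≤ᵉ fin (α + β)
    triangle-≤ {x} {y} {z} d≤α d≤β = ≤ᵉ-trans (triangle x y z) (+ᵉ-mono-≤ᵉ d≤α d≤β)

    record Cut (R P : Carrier) {y v} (W : Walk G y v) : Set (a ⊔ b) where
      field
        {z a′}         : Fin n
        c              : Carrier
        W₁             : Walk G y z
        e              : G z a′ (fin c)
        W₂             : Walk G a′ v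
        prefix-fits    : P + lenᴳ W₁ ≤ R
        edge-overflows : R ≤ P + lenᴳ W₁ + c
        lenᴳ-split     : lenᴳ W ≡ lenᴳ W₁ + c + lenᴳ W₂

    cut : ∀ {R P} → P ≤ R → ∀ {y v} (W : Walk G y v) → (P + lenᴳ W ≤ R) ⊎ Cut R P W
    cut {R} {P} P≤R [] = inj₁ (subst (_≤ R) (sym (+-identityʳ P)) P≤R)
    cut {R} {P} P≤R (step w (c , w≡c , c∈E) W) with total (P + c) R
    ... | inj₂ R≤P+c = inj₂ record
      { W₁ = [] ; e = c , refl , c∈E ; W₂ = W
      ; prefix-fits    = subst (_≤ R) (sym (+-identityʳ P)) P≤R
      ; edge-overflows = subst (R ≤_) (cong (_+ c) (sym (+-identityʳ P))) R≤P+c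
      ; lenᴳ-split     = cong (_+ lenᴳ W) (sym (+-identityˡ c))
      }
    ... | inj₁ P+c≤R with cut P+c≤R W
    ...   | inj₁ fits = inj₁ (subst (_≤ R) (+-assoc P c (lenᴳ W)) fits)
    ...   | inj₂ k = inj₂ record
      { W₁ = step w (c , w≡c , c∈E) W₁ ; e = e ; W₂ = W₂
      ; prefix-fits    = subst (_≤ R) (+-assoc P c (lenᴳ W₁)) prefix-fits
      ; edge-overflows = subst (R ≤_) (cong (_+ c′) (+-assoc P c (lenᴳ W₁))) edge-overflows
      ; lenᴳ-split     = trans (cong (c +_) lenᴳ-split)
          (solve 4 (λ c l c′ l′ → c :+ (l :+ c′ :+ l′) := c :+ l :+ c′ :+ l′)
                 refl c (lenᴳ W₁) c′ (lenᴳ W₂))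
      }
      where open Cut k renaming (c to c′)

    module Hopsets (lev : Fin n → ℕ) (p : ℕ → Fin n → Maybe (Fin n))
                   (near : ∀ i v → IsNearest d lev i v (p i v)) where
      open Hopset d lev p

      GH : EdgeRel (a ⊔ b)
      GH = GHRel E

      GH-sym : Symmetric GH
      GH-sym (inj₁ g) = inj₁ (GRel-sym g)
      GH-sym {x} {y} (inj₂ (inj₁ xy∈H , w≡d)) = inj₂ (inj₂ xy∈H , trans w≡d (d-sym x y))
      GH-sym {x} {y} (inj₂ (inj₂ yx∈H , w≡d)) = inj₂ (inj₁ yx∈H , trans w≡d (d-sym x y))

      d≤lenᴳᴴ : ∀ {x y} (P : Walk GH x y) → d x y ≤ᵉ len P
      d≤lenᴳᴴ [] = d≤len []
      d≤lenᴳᴴ {x} {y} (step {y = z} w (inj₁ g) P) =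
        ≤ᵉ-trans (triangle x z y) (+ᵉ-mono-≤ᵉ (d≤edge g) (d≤lenᴳᴴ P))
      d≤lenᴳᴴ {x} {y} (step {y = z} w (inj₂ (_ , w≡d)) P) =
        ≤ᵉ-trans (triangle x z y) (+ᵉ-mono-≤ᵉ (≤ᵉ-reflexive (sym w≡d)) (d≤lenᴳᴴ P))

      HopWalk : ℕ → Fin n → Fin n → Ext → Set (a ⊔ b)
      HopWalk h x y ℓ = Σ[ W ∈ Walk GH x y ] (hops W ℕ.≤ h × len W ≤ᵉ ℓ)

      HopWalk-reverse : ∀ {h x y ℓ} → HopWalk h x y ℓ → HopWalk h y x ℓ
      HopWalk-reverse {h} {ℓ = ℓ} (W , hops≤h , len≤ℓ) =
        reverse GH-sym W ,
        subst (ℕ._≤ h) (sym (hops-reverse GH-sym W)) hops≤h ,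
        subst (_≤ᵉ ℓ) (sym (len-reverse GH-sym W)) len≤ℓ

      d≤-sym : ∀ {x y ℓ} → d x y ≤ᵉ ℓ → d y x ≤ᵉ ℓ
      d≤-sym {x} {y} {ℓ} = subst (_≤ᵉ ℓ) (d-sym x y)

      len-++-step : ∀ {x y z v w α β γ} (V : Walk GH x y) {g : GH y z w} {W : Walk GH z v} →
                    len V ≤ᵉ fin α → w ≤ᵉ fin β → len W ≤ᵉ fin γ →
                    len (V ++ʷ step w g W) ≤ᵉ fin (α + (β + γ))
      len-++-step V V≤α w≤β W≤γ =
        subst (_≤ᵉ _) (sym (len-++ V _)) (+ᵉ-mono-≤ᵉ V≤α (+ᵉ-mono-≤ᵉ w≤β W≤γ))

      hops-++-step : ∀ {x y z v w} (V : Walk GH x y) {g : GH y z w} (W : Walk GH z v) →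
                     hops (V ++ʷ step w g W) ≡ hops V ℕ.+ suc (hops W)
      hops-++-step V W = hops-++ V _

      edge-or-pivot : ∀ {y w δ} → lev y ℕ.≤ lev w → d y w ≡ fin δ →
                      InH y w ⊎ Σ[ z ∈ Fin n ] (suc (lev y) ℕ.≤ lev z × InH y z × d y z ≤ᵉ d y w)
      edge-or-pivot {y} {w} {δ} lev≤ d≡δ with near (suc (lev y)) y
      ... | inj₁ (p≡nothing , _) = inj₁ (inj₁ (inj₁ (lev≤ , closer)))
        where closer = subst₂ _<ᵉ_ (sym d≡δ) (cong (maybe (d y) ∞) (sym p≡nothing)) (lift tt)
      ... | inj₂ (z , p≡z , lev-z , _) with <ᵉ⊎≥ᵉ δ (d y z)
      ...   | inj₁ closer =
        inj₁ (inj₁ (inj₁ (lev≤ , subst₂ _<ᵉ_ (sym d≡δ) (cong (maybe (d y) ∞) (sym p≡z)) closer)))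
      ...   | inj₂ farther =
        inj₂ (z , lev-z , inj₁ (inj₂ (lift p≡z)) , subst (d y z ≤ᵉ_) (sym d≡δ) farther)

      HopWalk-shortcut : ∀ {h x y L S} → d x y ≤ᵉ fin L →
                         HopWalk h x y (d x y +ᵉ fin S) → HopWalk h x y (fin (L + S))
      HopWalk-shortcut {S = S} d≤L (Q , hops≤h , len≤) =
        Q , hops≤h , ≤ᵉ-trans len≤ (+ᵉ-mono-≤ᵉ d≤L (≤ᵉ-refl {fin S}))

      ShortcutOrEscape : ℕ → ℕ → Carrier → Carrier → Fin n → Fin n → Set (a ⊔ b)
      ShortcutOrEscape i h S T u v =
        HopWalk h u v (d u v +ᵉ fin S) ⊎ Σ[ u′ ∈ Fin n ] (suc i ℕ.≤ lev u′ × HopWalk h u u′ (fin T))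

      Claim : ℕ → ℕ → Carrier → Carrier → Carrier → Set (a ⊔ b)
      Claim i h R S T = ∀ u v → d u v ≤ᵉ fin R → ShortcutOrEscape i h S T u v

      Claim-cong : ∀ {i h h′ R R′ S S′ T T′} → h ≡ h′ → R′ ≡ R → S ≡ S′ → T ≡ T′ →
                   Claim i h R S T → Claim i h′ R′ S′ T′
      Claim-cong refl refl refl refl claim = claim

      claim-base : ∀ {R S T} → 0# ≤ R → 0# ≤ S → R + S ≡ T → Claim 0 1 R S T
      claim-base {R} {S} {T} 0≤R 0≤S R+S≡T u v d≤R with lev u in lev-u
      ... | suc _ = inj₂ (u , subst (1 ℕ.≤_) (sym lev-u) (s≤s z≤n) , [] , z≤n , lift 0≤T)
        where 0≤T = subst (0# ≤_) R+S≡T (+-nonneg 0≤R 0≤S)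
      ... | zero with edge-or-pivot (subst (ℕ._≤ lev v) (sym lev-u) z≤n) (proj₂ (≤ᵉ-fin⇒fin d≤R))
      ...   | inj₁ uv∈H = inj₁ (step (d u v) (inj₂ (uv∈H , refl)) [] , s≤s z≤n ,
                                 +ᵉ-mono-≤ᵉ (≤ᵉ-refl {d u v}) (lift 0≤S))
      ...   | inj₂ (z , lev-z , uz∈H , d≤d) =
        inj₂ (z , subst (λ l → suc l ℕ.≤ lev z) lev-u lev-z , step (d u z) (inj₂ (uz∈H , refl)) [] , s≤s z≤n ,
              subst (_≤ᵉ fin T) (sym (+ᵉ-identityʳ (d u z)))
                (≤ᵉ-trans d≤d (≤ᵉ-weaken d≤R (subst (R ≤_) R+S≡T (x≤x+y R 0≤S)))))

      module Step {i h : ℕ} {R S T : Carrier} (0≤R : 0# ≤ R) (0≤S : 0# ≤ S) (R+S≡T : R + S ≡ T)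
                  (claim : Claim i h R S T) where

        0≤T : 0# ≤ T
        0≤T = subst (0# ≤_) R+S≡T (+-nonneg 0≤R 0≤S)

        record Blocked (x y : Fin n) (L : Carrier) : Set (a ⊔ b) where
          field
            {u′ w}  : Fin n
            u′-high : suc i ℕ.≤ lev u′
            w-high  : suc i ℕ.≤ lev w
            P₁      : Walk GH x u′
            hops-P₁ : hops P₁ ℕ.≤ h
            len-P₁  : len P₁ ≤ᵉ fin T
            P₂      : Walk GH w y
            hops-P₂ : hops P₂ ℕ.≤ h
            len-P₂  : len P₂ ≤ᵉ fin T
            d-gap   : d u′ w ≤ᵉ fin (T + (L + T))
            d-reach : d x w ≤ᵉ fin (L + T)

        Segment : Fin n → Fin n → Carrier → Set (a ⊔ b)
        Segment x y L = HopWalk h x y (fin (L + S)) ⊎ Blocked x y L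

        segment : ∀ {x y L} → d x y ≤ᵉ fin L → L ≤ R → Segment x y L
        segment {x} {y} {L} d≤L L≤R with claim x y (≤ᵉ-weaken d≤L L≤R)
        ... | inj₁ Q = inj₁ (HopWalk-shortcut d≤L Q)
        ... | inj₂ (u′ , u′-high , P₁ , hops-P₁ , len-P₁) with claim y x (≤ᵉ-weaken (d≤-sym d≤L) L≤R)
        ...   | inj₁ Q = inj₁ (HopWalk-reverse (HopWalk-shortcut (d≤-sym d≤L) Q))
        ...   | inj₂ (w , w-high , P₂′) with HopWalk-reverse P₂′
        ...     | P₂ , hops-P₂ , len-P₂ = inj₂ record
          { u′-high = u′-high ; w-high = w-high
          ; P₁ = P₁ ; hops-P₁ = hops-P₁ ; len-P₁ = len-P₁
          ; P₂ = P₂ ; hops-P₂ = hops-P₂ ; len-P₂ = len-P₂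
          ; d-gap = triangle-≤ (d≤-sym (≤ᵉ-trans (d≤lenᴳᴴ P₁) len-P₁)) d-reach
          ; d-reach = d-reach
          }
          where d-reach = triangle-≤ d≤L (d≤-sym (≤ᵉ-trans (d≤lenᴳᴴ P₂) len-P₂))

        Through : ℕ → Fin n → Fin n → Carrier → Set (a ⊔ b)
        Through m x v L = Σ[ Q ∈ Walk GH x v ] (hops Q ℕ.< m ℕ.* suc h × len Q ≤ᵉ fin (L + ι m * S))

        -- The two spare T in reach-slack pay for a new escape and the way back to x
        -- when another blocked segment is prepended.
        record Detour (m : ℕ) (x v : Fin n) (L : Carrier) : Set (a ⊔ b) where
          field
            {u′ w}      : Fin n
            u′-high     : suc i ℕ.≤ lev u′
            w-high      : suc i ℕ.≤ lev w
            P₁          : Walk GH x u′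
            P₂          : Walk GH w v
            hops-P₁P₂   : hops P₁ ℕ.+ suc (hops P₂) ℕ.≤ m ℕ.* suc h ℕ.+ h
            ℓ₁ gap ℓ₂ reach : Carrier
            len-P₁      : len P₁ ≤ᵉ fin ℓ₁
            d-gap       : d u′ w ≤ᵉ fin gap
            len-P₂      : len P₂ ≤ᵉ fin ℓ₂
            d-reach     : d x w ≤ᵉ fin reach
            cost-bound  : ℓ₁ + gap + ℓ₂ ≤ L + ι m * S + ι 4 * T
            reach-slack : reach + (T + T) ≤ ℓ₁ + gap

        Outcome : ℕ → Fin n → Fin n → Carrier → Set (a ⊔ b)
        Outcome m x v L = Through m x v L ⊎ Detour m x v L

        escape-slack : ∀ X → X + (T + T) ≤ T + (T + X)
        escape-slack X = ≤-reflexive (solve 2 (λ X T → X :+ (T :+ T) := T :+ (T :+ X)) refl X T)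

        one-more-segment : ∀ m K → K + ι m * S + ι 4 * T ≤ K + ι (suc m) * S + ι 4 * T
        one-more-segment m K = +-mono-≤ (ι 4 * T) (+-monoʳ-≤ K (ι*-≤-ι*-suc m 0≤S))

        single : ∀ m {x y L} → Segment x y L → Outcome (suc m) x y L
        single m {L = L} (inj₁ (Q , hops≤h , len≤)) =
          inj₁ (Q , ℕₚ.≤-trans (s≤s hops≤h) (ℕₚ.m≤m+n (suc h) (m ℕ.* suc h)) ,
                ≤ᵉ-weaken len≤ (+-monoʳ-≤ L (subst (S ≤_) (sym (ι*-suc m S)) (x≤x+y S (ι*-nonneg m 0≤S)))))
        single m {L = L} (inj₂ B) = inj₂ record
          { u′-high = u′-high ; w-high = w-high ; P₁ = P₁ ; P₂ = P₂
          ; hops-P₁P₂ = prepend-budget m h hops-P₁ (ℕₚ.≤-trans hops-P₂ (ℕₚ.m≤n+m h (m ℕ.* suc h)))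
          ; len-P₁ = len-P₁ ; d-gap = d-gap ; len-P₂ = len-P₂ ; d-reach = d-reach
          ; cost-bound = begin
              T + (T + (L + T)) + T         ≡⟨ solve 2 (λ L T → T :+ (T :+ (L :+ T)) :+ T := L :+ :ι 4 :* T) refl L T ⟩
              L + ι 4 * T                   ≤⟨ +-mono-≤ (ι 4 * T) (x≤x+y L (ι*-nonneg (suc m) 0≤S)) ⟩
              L + ι (suc m) * S + ι 4 * T   ∎
          ; reach-slack = escape-slack (L + T)
          }
          where open Blocked B
                open ≤-Reasoning

        through-prepend : ∀ {m x y a′ v L₁ c L₂} → HopWalk h x y (fin (L₁ + S)) → G y a′ (fin c) →
                          Through m a′ v L₂ → Through (suc m) x v (L₁ + c + L₂)
        through-prepend {m} {L₁ = L₁} {c} {L₂} (Q₁ , hops-Q₁ , len-Q₁) e (Q₂ , hops-Q₂ , len-Q₂) =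
          Q₁ ++ʷ step (fin c) (inj₁ e) Q₂ ,
          subst (ℕ._< suc m ℕ.* suc h) (sym (hops-++-step Q₁ Q₂)) (ℕₚ.+-mono-≤ (s≤s hops-Q₁) hops-Q₂) ,
          ≤ᵉ-rewrite (len-++-step Q₁ len-Q₁ (≤ᵉ-refl {fin c}) len-Q₂)
            (solve 5 (λ L₁ S c L₂ m → L₁ :+ S :+ (c :+ (L₂ :+ m :* S)) := L₁ :+ c :+ L₂ :+ (con 1 :+ m) :* S)
                   refl L₁ S c L₂ (ι m))

        detour-prepend : ∀ {m x y a′ v L₁ c L₂} → d x y ≤ᵉ fin L₁ → HopWalk h x y (fin (L₁ + S)) →
                         G y a′ (fin c) → Detour m a′ v L₂ → Detour (suc m) x v (L₁ + c + L₂)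
        detour-prepend {m} {L₁ = L₁} {c} {L₂} d≤L₁ (Q , hops-Q , len-Q) e D = record
          { u′-high = u′-high ; w-high = w-high
          ; P₁ = Q ++ʷ step (fin c) (inj₁ e) P₁ ; P₂ = P₂
          ; hops-P₁P₂ = subst (ℕ._≤ suc m ℕ.* suc h ℕ.+ h)
              (sym (trans (cong (ℕ._+ suc (hops P₂)) (hops-++-step Q P₁))
                          (ℕₚ.+-assoc (hops Q) (suc (hops P₁)) (suc (hops P₂)))))
              (prepend-budget m h hops-Q hops-P₁P₂)
          ; len-P₁ = len-++-step Q len-Q (≤ᵉ-refl {fin c}) len-P₁
          ; d-gap = d-gap ; len-P₂ = len-P₂
          ; d-reach = triangle-≤ (triangle-≤ d≤L₁ (d≤edge e)) d-reach
          ; cost-bound = begin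
              L₁ + S + (c + ℓ₁) + gap + ℓ₂
                ≡⟨ solve 6 (λ L₁ S c ℓ₁ g ℓ₂ → L₁ :+ S :+ (c :+ ℓ₁) :+ g :+ ℓ₂
                                                := L₁ :+ c :+ S :+ (ℓ₁ :+ g :+ ℓ₂))
                         refl L₁ S c ℓ₁ gap ℓ₂ ⟩
              L₁ + c + S + (ℓ₁ + gap + ℓ₂)
                ≤⟨ +-monoʳ-≤ (L₁ + c + S) cost-bound ⟩
              L₁ + c + S + (L₂ + ι m * S + ι 4 * T)
                ≡⟨ solve 6 (λ L₁ c S L₂ m F → L₁ :+ c :+ S :+ (L₂ :+ m :* S :+ F)
                                                := L₁ :+ c :+ L₂ :+ (con 1 :+ m) :* S :+ F)
                         refl L₁ c S L₂ (ι m) (ι 4 * T) ⟩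
              L₁ + c + L₂ + ι (suc m) * S + ι 4 * T ∎
          ; reach-slack = begin
              L₁ + c + reach + (T + T)    ≡⟨ +-assoc (L₁ + c) reach (T + T) ⟩
              L₁ + c + (reach + (T + T))  ≤⟨ +-monoʳ-≤ (L₁ + c) reach-slack ⟩
              L₁ + c + (ℓ₁ + gap)         ≤⟨ x≤x+y _ 0≤S ⟩
              L₁ + c + (ℓ₁ + gap) + S
                ≡⟨ solve 5 (λ L₁ c ℓ₁ g S → L₁ :+ c :+ (ℓ₁ :+ g) :+ S := L₁ :+ S :+ (c :+ ℓ₁) :+ g)
                         refl L₁ c ℓ₁ gap S ⟩
              L₁ + S + (c + ℓ₁) + gap     ∎
          }
          where open Detour D
                open ≤-Reasoning

        detour-start : ∀ {m x y a′ v L₁ c L₂} → Blocked x y L₁ → G y a′ (fin c) →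
                       Through m a′ v L₂ → Detour (suc m) x v (L₁ + c + L₂)
        detour-start {m} {L₁ = L₁} {c} {L₂} B e (Q , hops-Q , len-Q) = record
          { u′-high = u′-high ; w-high = w-high
          ; P₁ = P₁ ; P₂ = P₂ ++ʷ step (fin c) (inj₁ e) Q
          ; hops-P₁P₂ = subst (λ q → hops P₁ ℕ.+ suc q ℕ.≤ suc m ℕ.* suc h ℕ.+ h)
              (sym (hops-++-step P₂ Q))
              (prepend-budget m h hops-P₁
                (subst (hops P₂ ℕ.+ suc (hops Q) ℕ.≤_) (ℕₚ.+-comm h (m ℕ.* suc h))
                  (ℕₚ.+-mono-≤ hops-P₂ hops-Q)))
          ; len-P₁ = len-P₁ ; d-gap = d-gap
          ; len-P₂ = len-++-step P₂ len-P₂ (≤ᵉ-refl {fin c}) len-Q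
          ; d-reach = d-reach
          ; cost-bound = begin
              T + (T + (L₁ + T)) + (T + (c + (L₂ + ι m * S)))
                ≡⟨ solve 6 (λ L₁ c L₂ m S T → T :+ (T :+ (L₁ :+ T)) :+ (T :+ (c :+ (L₂ :+ m :* S)))
                                              := L₁ :+ c :+ L₂ :+ m :* S :+ :ι 4 :* T)
                         refl L₁ c L₂ (ι m) S T ⟩
              L₁ + c + L₂ + ι m * S + ι 4 * T        ≤⟨ one-more-segment m (L₁ + c + L₂) ⟩
              L₁ + c + L₂ + ι (suc m) * S + ι 4 * T  ∎
          ; reach-slack = escape-slack (L₁ + T)
          }
          where open Blocked B
                open ≤-Reasoning

        detour-restart : ∀ {m x y a′ v L₁ c L₂} → d x y ≤ᵉ fin L₁ → Blocked x y L₁ → G y a′ (fin c) →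
                         Detour m a′ v L₂ → Detour (suc m) x v (L₁ + c + L₂)
        detour-restart {m} {L₁ = L₁} {c} {L₂} d≤L₁ B e D = record
          { u′-high = escape-high ; w-high = w-high
          ; P₁ = escape ; P₂ = P₂
          ; hops-P₁P₂ = prepend-budget m h hops-escape
              (ℕₚ.≤-trans (ℕₚ.≤-trans (ℕₚ.n≤1+n _) (ℕₚ.m≤n+m (suc (hops P₂)) (hops P₁))) hops-P₁P₂)
          ; len-P₁ = len-escape
          ; d-gap = triangle-≤ (d≤-sym (≤ᵉ-trans (d≤lenᴳᴴ escape) len-escape)) d-reach′
          ; len-P₂ = len-P₂
          ; d-reach = d-reach′
          ; cost-bound = begin
              T + (T + (L₁ + c + reach)) + ℓ₂
                ≡⟨ solve 5 (λ L₁ c r ℓ₂ T → T :+ (T :+ (L₁ :+ c :+ r)) :+ ℓ₂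
                                             := L₁ :+ c :+ (r :+ (T :+ T) :+ ℓ₂))
                         refl L₁ c reach ℓ₂ T ⟩
              L₁ + c + (reach + (T + T) + ℓ₂)         ≤⟨ +-monoʳ-≤ (L₁ + c) (+-mono-≤ ℓ₂ reach-slack) ⟩
              L₁ + c + (ℓ₁ + gap + ℓ₂)                ≤⟨ +-monoʳ-≤ (L₁ + c) cost-bound ⟩
              L₁ + c + (L₂ + ι m * S + ι 4 * T)
                ≡⟨ solve 5 (λ L₁ c L₂ X F → L₁ :+ c :+ (L₂ :+ X :+ F) := L₁ :+ c :+ L₂ :+ X :+ F)
                         refl L₁ c L₂ (ι m * S) (ι 4 * T) ⟩
              L₁ + c + L₂ + ι m * S + ι 4 * T         ≤⟨ one-more-segment m (L₁ + c + L₂) ⟩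
              L₁ + c + L₂ + ι (suc m) * S + ι 4 * T   ∎
          ; reach-slack = escape-slack (L₁ + c + reach)
          }
          where open Detour D
                open Blocked B using ()
                  renaming (u′-high to escape-high; P₁ to escape; hops-P₁ to hops-escape; len-P₁ to len-escape)
                open ≤-Reasoning
                d-reach′ = triangle-≤ (triangle-≤ d≤L₁ (d≤edge e)) d-reach

        extend : ∀ {m x y a′ v L₁ c L₂} → d x y ≤ᵉ fin L₁ → Segment x y L₁ → G y a′ (fin c) →
                 Outcome m a′ v L₂ → Outcome (suc m) x v (L₁ + c + L₂)
        extend {m} d≤L₁ (inj₁ Q) e (inj₁ Q′) = inj₁ (through-prepend {m} Q e Q′)
        extend d≤L₁ (inj₁ Q) e (inj₂ D)  = inj₂ (detour-prepend d≤L₁ Q e D)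
        extend d≤L₁ (inj₂ B) e (inj₁ Q′) = inj₂ (detour-start B e Q′)
        extend d≤L₁ (inj₂ B) e (inj₂ D)  = inj₂ (detour-restart d≤L₁ B e D)

        outcome : ∀ m {x v} (W : Walk G x v) → lenᴳ W ≤ ι (suc m) * R → Outcome (suc m) x v (lenᴳ W)
        outcome zero W W≤R = single zero (segment (d≤lenᴳ W) (subst (lenᴳ W ≤_) (ι*-1 R) W≤R))
          where ι*-1 : ∀ x → ι 1 * x ≡ x
                ι*-1 = solve 1 (λ x → :ι 1 :* x := x) refl
        outcome (suc m) W W≤ with cut 0≤R W
        ... | inj₁ fits = single (suc m) (segment (d≤lenᴳ W) (subst (_≤ R) (+-identityˡ _) fits))
        ... | inj₂ k = subst (Outcome (suc (suc m)) _ _) (sym lenᴳ-split)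
                        (extend (d≤lenᴳ W₁) (segment (d≤lenᴳ W₁) W₁≤R) e (outcome m W₂ rest≤))
          where
          open Cut k
          open ≤-Reasoning
          W₁≤R : lenᴳ W₁ ≤ R
          W₁≤R = subst (_≤ R) (+-identityˡ _) prefix-fits

          rest≤ : lenᴳ W₂ ≤ ι (suc m) * R
          rest≤ = +-cancelˡ-≤ (lenᴳ W₁ + c) (begin
            lenᴳ W₁ + c + lenᴳ W₂      ≡⟨ lenᴳ-split ⟨
            lenᴳ W                     ≤⟨ W≤ ⟩
            ι (suc (suc m)) * R        ≡⟨ ι*-suc (suc m) R ⟩
            R + ι (suc m) * R          ≤⟨ +-mono-≤ _ (subst (R ≤_) (cong (_+ c) (+-identityˡ _)) edge-overflows) ⟩
            lenᴳ W₁ + c + ι (suc m) * R ∎)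

        detour-resolve : ∀ r′ {u v L} → d u v ≡ fin L → L ≤ ι (suc r′) * R → Detour (suc r′) u v L →
                         ShortcutOrEscape (suc i) (suc r′ ℕ.* suc h ℕ.+ h)
                                          (ι (suc r′) * S + ι 4 * T) (ι (suc r′) * T + ι 4 * T) u v
        detour-resolve r′ {u} {v} {L} d≡L L≤rR D = resolve (suc (suc i) ℕ.≤? lev u′)
          where
          open Detour D
          open ≤-Reasoning
          r = suc r′

          ℓ₁+gap≤ : ℓ₁ + gap ≤ ι r * T + ι 4 * T
          ℓ₁+gap≤ = begin
            ℓ₁ + gap                     ≤⟨ x≤x+y _ (d≤fin⇒nonneg (≤ᵉ-trans (d≤lenᴳᴴ P₂) len-P₂)) ⟩
            ℓ₁ + gap + ℓ₂                ≤⟨ cost-bound ⟩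
            L + ι r * S + ι 4 * T        ≤⟨ +-mono-≤ _ (+-mono-≤ _ L≤rR) ⟩
            ι r * R + ι r * S + ι 4 * T  ≡⟨ cong (_+ ι 4 * T) (distribˡ (ι r) R S) ⟨
            ι r * (R + S) + ι 4 * T      ≡⟨ cong (λ t → ι r * t + ι 4 * T) R+S≡T ⟩
            ι r * T + ι 4 * T            ∎

          lev-u′≡ : ¬ (suc (suc i) ℕ.≤ lev u′) → lev u′ ≡ suc i
          lev-u′≡ low = ℕₚ.≤-antisym (ℕₚ.≤-pred (ℕₚ.≰⇒> low)) u′-high

          resolve : Dec (suc (suc i) ℕ.≤ lev u′) →
                    ShortcutOrEscape (suc i) (r ℕ.* suc h ℕ.+ h) (ι r * S + ι 4 * T) (ι r * T + ι 4 * T) u v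
          resolve (yes high) =
            inj₂ (u′ , high , P₁ , ℕₚ.≤-trans (ℕₚ.m≤m+n _ _) hops-P₁P₂ ,
                  ≤ᵉ-weaken len-P₁ (≤-trans (x≤x+y ℓ₁ (d≤fin⇒nonneg d-gap)) ℓ₁+gap≤))
          resolve (no low) with edge-or-pivot (subst (ℕ._≤ lev w) (sym (lev-u′≡ low)) w-high)
                                              (proj₂ (≤ᵉ-fin⇒fin d-gap))
          ... | inj₁ u′w∈H =
            let bridge = P₁ ++ʷ step (d u′ w) (inj₂ (u′w∈H , refl)) P₂ in
            inj₁ (bridge ,
                  subst (ℕ._≤ r ℕ.* suc h ℕ.+ h) (sym (hops-++-step P₁ P₂)) hops-P₁P₂ ,
                  subst (λ t → len bridge ≤ᵉ (t +ᵉ fin (ι r * S + ι 4 * T))) (sym d≡L)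
                    (≤ᵉ-weaken (len-++-step P₁ len-P₁ d-gap len-P₂) (begin
                      ℓ₁ + (gap + ℓ₂)              ≡⟨ +-assoc ℓ₁ gap ℓ₂ ⟨
                      ℓ₁ + gap + ℓ₂                ≤⟨ cost-bound ⟩
                      L + ι r * S + ι 4 * T        ≡⟨ +-assoc L (ι r * S) (ι 4 * T) ⟩
                      L + (ι r * S + ι 4 * T)      ∎)))
          ... | inj₂ (z , lev-z , u′z∈H , d≤d) =
            inj₂ (z , subst (λ l → suc l ℕ.≤ lev z) (lev-u′≡ low) lev-z ,
                  P₁ ++ʷ step (d u′ z) (inj₂ (u′z∈H , refl)) [] ,
                  subst (ℕ._≤ r ℕ.* suc h ℕ.+ h) (sym (hops-++-step P₁ []))
                    (ℕₚ.≤-trans (ℕₚ.+-monoʳ-≤ (hops P₁) (s≤s z≤n)) hops-P₁P₂) ,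
                  ≤ᵉ-weaken (len-++-step P₁ len-P₁ (≤ᵉ-trans d≤d d-gap) (≤ᵉ-refl {fin 0#}))
                    (subst (_≤ ι r * T + ι 4 * T) (cong (ℓ₁ +_) (sym (+-identityʳ gap))) ℓ₁+gap≤))

        conclude : ∀ r′ {u v L} → d u v ≡ fin L → L ≤ ι (suc r′) * R → Outcome (suc r′) u v L →
                   ShortcutOrEscape (suc i) (suc r′ ℕ.* suc h ℕ.+ h)
                                    (ι (suc r′) * S + ι 4 * T) (ι (suc r′) * T + ι 4 * T) u v
        conclude r′ {L = L} d≡L _ (inj₁ (Q , hops-Q , len-Q)) =
          inj₁ (Q , ℕₚ.≤-trans (ℕₚ.<⇒≤ hops-Q) (ℕₚ.m≤m+n _ h) ,
                subst (λ t → len Q ≤ᵉ (t +ᵉ fin (ι (suc r′) * S + ι 4 * T))) (sym d≡L)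
                  (≤ᵉ-weaken len-Q (+-monoʳ-≤ L (x≤x+y _ (ι*-nonneg 4 0≤T)))))
        conclude r′ d≡L L≤rR (inj₂ D) = detour-resolve r′ d≡L L≤rR D

        claim-step : ∀ r′ → Claim (suc i) (suc r′ ℕ.* suc h ℕ.+ h) (ι (suc r′) * R)
                                  (ι (suc r′) * S + ι 4 * T) (ι (suc r′) * T + ι 4 * T)
        claim-step r′ u v d≤rR with ≤ᵉ-fin⇒fin d≤rR
        ... | L , d≡L with shortest-walk d≡L
        ...   | W , refl = conclude r′ d≡L L≤rR (outcome r′ W L≤rR)
          where L≤rR = lower (subst (_≤ᵉ _) d≡L d≤rR)

      claims : ∀ r′ {μ} → 0# ≤ μ → ∀ i →
               let r = suc r′ in
               Claim i (hop r i) (ι (r ^ i) * μ) (ι (slack r i) * μ) (ι ((r ℕ.+ 4) ^ i) * μ)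
      claims r′ {μ} 0≤μ = go
        where
        r = suc r′
        A B : ℕ → ℕ
        A i = (r ℕ.+ 4) ^ i
        B i = r ^ i

        R+S≡T : ∀ i → ι (B i) * μ + ι (slack r i) * μ ≡ ι (A i) * μ
        R+S≡T i = trans (sym (ι*-+ (B i) (slack r i) μ)) (cong (λ t → ι t * μ) (^+slack≡[+4]^ r i))

        go : ∀ i → Claim i (hop r i) (ι (B i) * μ) (ι (slack r i) * μ) (ι (A i) * μ)
        go zero = claim-base (ι*-nonneg 1 0≤μ) (ι*-nonneg 0 0≤μ) (R+S≡T 0)
        go (suc i) = Claim-cong (hop-suc r i) (ι*-* r (B i) μ) S-step T-step
          (Step.claim-step (ι*-nonneg (B i) 0≤μ) (ι*-nonneg (slack r i) 0≤μ) (R+S≡T i) (go i) r′)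
          where
          S-step : ι r * (ι (slack r i) * μ) + ι 4 * (ι (A i) * μ) ≡ ι (slack r (suc i)) * μ
          S-step = sym (trans (ι*-+ (r ℕ.* slack r i) (4 ℕ.* A i) μ)
                              (cong₂ _+_ (ι*-* r (slack r i) μ) (ι*-* 4 (A i) μ)))
          T-step : ι r * (ι (A i) * μ) + ι 4 * (ι (A i) * μ) ≡ ι (A (suc i)) * μ
          T-step = sym (trans (cong (λ t → ι t * μ) (ℕₚ.*-distribʳ-+ (A i) r 4))
                              (trans (ι*-+ (r ℕ.* A i) (4 ℕ.* A i) μ)
                                     (cong₂ _+_ (ι*-* r (A i) μ) (ι*-* 4 (A i) μ))))

theorem4 : ∀ {a b : Level} (O : OrderedCommRing a b) →
    let open OrderedCommRing O in
    let open WithRing O in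
    (n k r : ℕ) → 1 ℕ.≤ k → 2 ℕ.≤ r →
    let open Graph n in
    (E : EdgeList) → (∀ x y c → (x , y , c) ∈ E → 0# ≤ c) →
    (lev : Fin n → ℕ) → (∀ v → lev v ℕ.≤ k) →
    (d : Fin n → Fin n → Ext) → (∀ u v → IsDist E u v (d u v)) →
    (p : ℕ → Fin n → Maybe (Fin n)) → (∀ i v → IsNearest d lev i v (p i v)) →
    let open Hopset d lev p in
    (μ : Carrier) (i : ℕ) → i ℕ.≤ k → (u v : Fin n) →
    d u v ≤ᵉ fin (ι (r ^ i) * μ) →
    (Σ[ W ∈ Walk (GHRel E) u v ]
       (hops W ℕ.≤ hop r i
        × len W ≤ᵉ (d u v +ᵉ fin ((ι ((r ℕ.+ 4) ^ i) - ι (r ^ i)) * μ))))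
    ⊎ (Σ[ u′ ∈ Fin n ] (suc i ℕ.≤ lev u′
        × Σ[ W ∈ Walk (GHRel E) u u′ ]
            (hops W ℕ.≤ hop r i × len W ≤ᵉ fin (ι ((r ℕ.+ 4) ^ i) * μ))))
theorem4 O n k zero _ ()
theorem4 O n k (suc r′) _ _ E E-nonneg lev _ d d-isDist p near μ i _ u v d≤ =
  Claim-cong refl refl slack≡ refl (claims r′ 0≤μ i) u v d≤
  where
  open OrderedCommRing O
  open WithRing O
  open OrderedRingProperties O
  open Distances.Shortest O n E E-nonneg d d-isDist
  open Hopsets lev p near
  r = suc r′

  0≤μ : 0# ≤ μ
  0≤μ = nonneg-of-multiple (ℕₚ.m^n>0 r i) (d≤fin⇒nonneg d≤)

  slack≡ : ι (slack r i) * μ ≡ (ι ((r ℕ.+ 4) ^ i) - ι (r ^ i)) * μ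
  slack≡ = cong (_* μ) (sym (begin
    ι ((r ℕ.+ 4) ^ i) - ι (r ^ i)              ≡⟨ cong (λ t → ι t - ι (r ^ i)) (^+slack≡[+4]^ r i) ⟨
    ι (r ^ i ℕ.+ slack r i) - ι (r ^ i)        ≡⟨ cong (_- ι (r ^ i)) (ι-+ (r ^ i) (slack r i)) ⟩
    (ι (r ^ i) + ι (slack r i)) - ι (r ^ i)    ≡⟨ x+y-x≡y (ι (r ^ i)) (ι (slack r i)) ⟩
    ι (slack r i)                              ∎))
    where open ≡-Reasoning
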